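{- Every frame of a Dyck path of positive length can be written as $a^m(s(\mathbf J))$ for some frame $\mathbf J$ of a Dyck path and some integer $m\ge 0$; that is, it is obtained from a frame by one lifting followed by a suitable number (possibly zero) of extensions.
   Context: A Dyck path of length $2n$ is a lattice path from $(0,0)$ to $(2n,0)$ with steps $U=(1,1)$, $D=(1,-1)$ never going below the $x$-axis. The frame of a Dyck path is the eventually zero sequence $(i_0,i_1,i_2,\ldots)$ where $i_k$ is the number of vertices of the path (including endpoints) at height $k$. On eventually zero integer sequences define the lifting $s(i_0,i_1,i_2,\ldots)=(2,i_0,i_1,i_2,\ldots)$ and the extension $a(i_0,i_1,i_2,\ldots)=(i_0+1,i_1+1,i_2,\ldots)$. (If $\mathbf J$ is the frame of a path $\mathbf p$, then $s(\mathbf J)$ is the frame of $U\mathbf pD$ and $a(\mathbf J)$ is the frame of $\mathbf pUD$.) -}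

module Defs where

open import Data.Nat using (ℕ; zero; suc; _+_; _≟_)
open import Data.List using (List; []; _∷_; length; filter)
open import Data.Bool using (Bool; true; false)
open import Relation.Nullary.Decidable using (⌊_⌋)
open import Data.Empty using (⊥)
open import Data.Unit using (⊤)

-- Steps of a lattice path: U = (1,1), D = (1,-1)
data Step : Set where
  U D : Step

Path : Set
Path = List Step

-- A path starting at height h stays at height ≥ 0 and ends at height 0.
-- (Heights are natural numbers, so a D-step from height 0 is rejected.)
DyckFrom : ℕ → Path → Set
DyckFrom zero    []      = ⊤
DyckFrom (suc h) []      = ⊥
DyckFrom h       (U ∷ p) = DyckFrom (suc h) p
DyckFrom zero    (D ∷ p) = ⊥
DyckFrom (suc h) (D ∷ p) = DyckFrom h p

IsDyck : Path → Set
IsDyck = DyckFrom 0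

-- Heights of all vertices (including both endpoints) of a path started at
-- height h; a D-step from height 0 is truncated (irrelevant for Dyck paths).
heightsFrom : ℕ → Path → List ℕ
heightsFrom h []      = h ∷ []
heightsFrom h (U ∷ p) = h ∷ heightsFrom (suc h) p
heightsFrom h (D ∷ p) = h ∷ heightsFrom (Data.Nat.pred h) p

heights : Path → List ℕ
heights = heightsFrom 0

-- Eventually zero integer sequences, represented as functions ℕ → ℕ
-- (entries are vertex counts, hence natural numbers); compared pointwise.
Seq : Set
Seq = ℕ → ℕ

frame : Path → Seq
frame p k = length (filter (λ h → h ≟ k) (heights p))

lift : Seq → Seq
lift J zero    = 2
lift J (suc k) = J k

ext : Seq → Seq
ext J zero          = suc (J 0)
ext J (suc zero)    = suc (J 1)
ext J (suc (suc k)) = J (suc (suc k))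

ext^ : ℕ → Seq → Seq
ext^ zero    J = J
ext^ (suc m) J = ext (ext^ m J)

module Submission where

-- A nonempty Dyck path factors at its first return to the axis as
-- p = (U p₁ D) ++ p₂ with p₁, p₂ Dyck.  Frames turn this factorisation into
-- arithmetic on sequences:
--   * elevation:      frame (U p₁ D)     = s(frame p₁);
--   * concatenation:  δ₀ + frame (a ++ b) = frame a + frame b   (a Dyck),
--     where δ₀ = (1,0,0,…) accounts for the vertex shared by a and b.
-- If p₂ is empty, p has frame s(frame p₁).  Otherwise, by strong induction on
-- the length, frame p₂ = aᵐ(s(frame q₂)), and a short computation with the two
-- identities above shows frame p = aᵐ⁺¹(s(frame (p₁ ++ q₂))).

open import Defs
open import Data.Nat using (ℕ; _>_)
open import Data.List using (length)
open import Data.Product using (Σ; _×_)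
open import Relation.Binary.PropositionalEquality using (_≡_)

open import Data.Nat using (zero; suc; _+_; _≟_; _<_; s≤s; z≤n)
open import Data.Nat.Properties
  using (+-comm; +-suc; +-identityʳ; +-cancelˡ-≡; m<n+m; +-commutativeSemigroup)
open import Data.List using (List; []; _∷_; _++_; map; filter; drop)
open import Data.List.Properties using (length-++; filter-++; map-cong; map-id; ++-assoc; ++-identityʳ)
open import Data.Product using (_,_)
open import Data.Unit using (tt)
open import Data.Bool using (true; false)
open import Relation.Nullary using (does)
open import Function using (_on_)
open import Algebra.Properties.CommutativeSemigroup +-commutativeSemigroup using (x∙yz≈y∙xz)
open import Induction.WellFounded using (Acc; acc)
open import Data.Nat.Induction using (<-wellFounded)
open import Relation.Binary.Construct.On using (wellFounded)
open import Relation.Binary.PropositionalEquality using (_≗_; refl; sym; trans; cong; cong₂; module ≡-Reasoning)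

occurrences : ℕ → List ℕ → ℕ
occurrences k hs = length (filter (_≟ k) hs)

occurrences-++ : ∀ k hs hs′ → occurrences k (hs ++ hs′) ≡ occurrences k hs + occurrences k hs′
occurrences-++ k hs hs′ = trans (cong length (filter-++ (_≟ k) hs hs′)) (length-++ (filter (_≟ k) hs))

-- Raising every height by one moves each count up one level, and leaves
-- nothing at level 0.  (suc h ≟ suc k and h ≟ k decide the same boolean.)
occurrences-map-suc : ∀ k hs → occurrences (suc k) (map suc hs) ≡ occurrences k hs
occurrences-map-suc k []       = refl
occurrences-map-suc k (h ∷ hs) with does (h ≟ k)
... | true  = cong suc (occurrences-map-suc k hs)
... | false = occurrences-map-suc k hs

occurrences-zero-map-suc : ∀ hs → occurrences 0 (map suc hs) ≡ 0
occurrences-zero-map-suc []       = refl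
occurrences-zero-map-suc (h ∷ hs) = occurrences-zero-map-suc hs

_⊕_ : Seq → Seq → Seq
(J ⊕ J′) k = J k + J′ k

infixl 6 _⊕_

δ₀ : Seq
δ₀ zero    = 1
δ₀ (suc _) = 0

occurrences-zero-∷ : ∀ k hs → occurrences k (0 ∷ hs) ≡ δ₀ k + occurrences k hs
occurrences-zero-∷ zero    hs = refl
occurrences-zero-∷ (suc k) hs = refl

heightsFrom-head : ∀ h p → heightsFrom h p ≡ h ∷ drop 1 (heightsFrom h p)
heightsFrom-head h []      = refl
heightsFrom-head h (U ∷ p) = refl
heightsFrom-head h (D ∷ p) = refl

-- A path a that descends from height h to 0 without going below 0, started
-- k levels higher and followed by b, visits the heights of a raised by k and
-- then those of b (whose first vertex is the last vertex of a).
heightsFrom-++ : ∀ h k a b → DyckFrom h a →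
  heightsFrom (h + k) (a ++ b) ≡ map (_+ k) (heightsFrom h a) ++ drop 1 (heightsFrom k b)
heightsFrom-++ zero    k []      b _ = heightsFrom-head k b
heightsFrom-++ zero    k (U ∷ a) b d = cong (k ∷_) (heightsFrom-++ 1 k a b d)
heightsFrom-++ (suc h) k (U ∷ a) b d = cong (suc (h + k) ∷_) (heightsFrom-++ (suc (suc h)) k a b d)
heightsFrom-++ (suc h) k (D ∷ a) b d = cong (suc (h + k) ∷_) (heightsFrom-++ h k a b d)

DyckFrom-U : ∀ h p → DyckFrom (suc h) p → DyckFrom h (U ∷ p)
DyckFrom-U zero    p d = d
DyckFrom-U (suc h) p d = d

DyckFrom-++ : ∀ h k a b → DyckFrom h a → DyckFrom k b → DyckFrom (h + k) (a ++ b)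
DyckFrom-++ zero    k []      b _  db = db
DyckFrom-++ zero    k (U ∷ a) b da db = DyckFrom-U k (a ++ b) (DyckFrom-++ 1 k a b da db)
DyckFrom-++ (suc h) k (U ∷ a) b da db = DyckFrom-++ (suc (suc h)) k a b da db
DyckFrom-++ (suc h) k (D ∷ a) b da db = DyckFrom-++ h k a b da db

wrap : Path → Path
wrap p = U ∷ p ++ D ∷ []

wrap-Dyck : ∀ p → IsDyck p → IsDyck (wrap p)
wrap-Dyck p d = DyckFrom-++ 0 1 p (D ∷ []) d tt

heights-wrap : ∀ p → IsDyck p → heights (wrap p) ≡ 0 ∷ map suc (heights p) ++ 0 ∷ []
heights-wrap p d = cong (0 ∷_) (begin
  heightsFrom 1 (p ++ D ∷ [])                    ≡⟨ heightsFrom-++ 0 1 p (D ∷ []) d ⟩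
  map (_+ 1) (heights p) ++ 0 ∷ []               ≡⟨ cong (_++ 0 ∷ []) (map-cong (λ h → +-comm h 1) (heights p)) ⟩
  map suc (heights p) ++ 0 ∷ []                  ∎)
  where open ≡-Reasoning

heights-++ : ∀ a b → IsDyck a → heights (a ++ b) ≡ heights a ++ drop 1 (heights b)
heights-++ a b d = begin
  heights (a ++ b)                               ≡⟨ heightsFrom-++ 0 0 a b d ⟩
  map (_+ 0) (heights a) ++ drop 1 (heights b)   ≡⟨ cong (_++ drop 1 (heights b)) map-+0 ⟩
  heights a ++ drop 1 (heights b)                ∎
  where
  open ≡-Reasoning
  map-+0 : map (_+ 0) (heights a) ≡ heights a
  map-+0 = trans (map-cong +-identityʳ (heights a)) (map-id (heights a))

frame-wrap : ∀ p → IsDyck p → frame (wrap p) ≗ lift (frame p)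
frame-wrap p d k = trans (cong (occurrences k) (heights-wrap p d)) (count k)
  where
  hs : List ℕ
  hs = map suc (heights p)
  count : ∀ k → occurrences k (0 ∷ hs ++ 0 ∷ []) ≡ lift (frame p) k
  count zero    = cong suc (trans (occurrences-++ 0 hs (0 ∷ []))
                                  (cong (_+ 1) (occurrences-zero-map-suc (heights p))))
  count (suc k) = trans (occurrences-++ (suc k) hs (0 ∷ []))
                        (trans (+-identityʳ _) (occurrences-map-suc k (heights p)))

frame-++ : ∀ a b → IsDyck a → δ₀ ⊕ frame (a ++ b) ≗ frame a ⊕ frame b
frame-++ a b d k = begin
  δ₀ k + frame (a ++ b) k                        ≡⟨ cong (λ hs → δ₀ k + occurrences k hs) (heights-++ a b d) ⟩
  δ₀ k + occurrences k (heights a ++ rest)       ≡⟨ cong (δ₀ k +_) (occurrences-++ k (heights a) rest) ⟩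
  δ₀ k + (frame a k + occurrences k rest)        ≡⟨ x∙yz≈y∙xz (δ₀ k) (frame a k) _ ⟩
  frame a k + (δ₀ k + occurrences k rest)        ≡⟨ cong (frame a k +_) (sym (occurrences-zero-∷ k rest)) ⟩
  frame a k + occurrences k (0 ∷ rest)           ≡⟨ cong (λ hs → frame a k + occurrences k hs) (sym (heightsFrom-head 0 b)) ⟩
  frame a k + frame b k                          ∎
  where
  open ≡-Reasoning
  rest : List ℕ
  rest = drop 1 (heights b)

ext-cong : ∀ {J J′} → J ≗ J′ → ext J ≗ ext J′
ext-cong e zero          = cong suc (e 0)
ext-cong e (suc zero)    = cong suc (e 1)
ext-cong e (suc (suc k)) = e (suc (suc k))

ext^-cong : ∀ m {J J′} → J ≗ J′ → ext^ m J ≗ ext^ m J′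
ext^-cong zero    e = e
ext^-cong (suc m) e = ext-cong (ext^-cong m e)

ext^-ext : ∀ m J → ext^ m (ext J) ≗ ext^ (suc m) J
ext^-ext zero    J k = refl
ext^-ext (suc m) J   = ext-cong (ext^-ext m J)

⊕-ext : ∀ J J′ → J ⊕ ext J′ ≗ ext (J ⊕ J′)
⊕-ext J J′ zero          = +-suc (J 0) (J′ 0)
⊕-ext J J′ (suc zero)    = +-suc (J 1) (J′ 1)
⊕-ext J J′ (suc (suc k)) = refl

⊕-ext^ : ∀ m J J′ → J ⊕ ext^ m J′ ≗ ext^ m (J ⊕ J′)
⊕-ext^ zero    J J′ k = refl
⊕-ext^ (suc m) J J′ k = trans (⊕-ext J (ext^ m J′) k) (ext-cong (⊕-ext^ m J J′) k)

-- The sum of two lifted sequences is one extension of a lifted sequence: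
-- if K is J and J′ glued at one shared vertex of height 0, then
-- s(J) + s(J′) = δ₀ + a(s(K)).
lift-⊕ : ∀ J J′ K → δ₀ ⊕ K ≗ J ⊕ J′ → lift J ⊕ lift J′ ≗ δ₀ ⊕ ext (lift K)
lift-⊕ J J′ K glued zero          = refl
lift-⊕ J J′ K glued (suc zero)    = sym (glued 0)
lift-⊕ J J′ K glued (suc (suc k)) = sym (glued (suc k))

-- First-return factorisation, generalised so that it is structural: a path
-- admissible from height d + 1 + h first reaches height h by a D-step, and
-- splits there into a part a admissible from d and a rest b admissible from h.
firstDescent : ∀ d h r → DyckFrom (d + suc h) r →
  Σ Path λ a → Σ Path λ b → r ≡ a ++ D ∷ b × DyckFrom d a × DyckFrom h b
firstDescent zero    h (D ∷ r) dr = [] , r , refl , tt , dr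
firstDescent zero    h (U ∷ r) dr with firstDescent 1 h r dr
... | a , b , refl , da , db = U ∷ a , b , refl , da , db
firstDescent (suc d) h (U ∷ r) dr with firstDescent (suc (suc d)) h r dr
... | a , b , refl , da , db = U ∷ a , b , refl , da , db
firstDescent (suc d) h (D ∷ r) dr with firstDescent d h r dr
... | a , b , refl , da , db = D ∷ a , b , refl , da , db

factorise : ∀ p → IsDyck p → length p > 0 →
  Σ Path λ p₁ → Σ Path λ p₂ → p ≡ wrap p₁ ++ p₂ × IsDyck p₁ × IsDyck p₂
factorise []      _ ()
factorise (D ∷ r) () _
factorise (U ∷ r) d _ with firstDescent 0 0 r d
... | a , b , refl , da , db = a , b , cong (U ∷_) (sym (++-assoc a (D ∷ []) b)) , da , db

suffix-shorter : ∀ p₁ p₂ → length p₂ < length (wrap p₁ ++ p₂)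
suffix-shorter p₁ p₂ rewrite length-++ (wrap p₁) {p₂} = m<n+m (length p₂) (s≤s z≤n)

frame-step : ∀ p₁ p₂ q₂ m → IsDyck p₁ →
  frame p₂ ≗ ext^ m (lift (frame q₂)) →
  frame (wrap p₁ ++ p₂) ≗ ext^ (suc m) (lift (frame (p₁ ++ q₂)))
frame-step p₁ p₂ q₂ m d₁ eq₂ k = +-cancelˡ-≡ (δ₀ k) _ _ (begin
  δ₀ k + frame (wrap p₁ ++ p₂) k              ≡⟨ frame-++ (wrap p₁) p₂ (wrap-Dyck p₁ d₁) k ⟩
  frame (wrap p₁) k + frame p₂ k              ≡⟨ cong₂ _+_ (frame-wrap p₁ d₁ k) (eq₂ k) ⟩
  lift J k + ext^ m (lift J′) k               ≡⟨ ⊕-ext^ m (lift J) (lift J′) k ⟩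
  ext^ m (lift J ⊕ lift J′) k                 ≡⟨ ext^-cong m (lift-⊕ J J′ K (frame-++ p₁ q₂ d₁)) k ⟩
  ext^ m (δ₀ ⊕ ext (lift K)) k                ≡⟨ sym (⊕-ext^ m δ₀ (ext (lift K)) k) ⟩
  δ₀ k + ext^ m (ext (lift K)) k              ≡⟨ cong (δ₀ k +_) (ext^-ext m (lift K) k) ⟩
  δ₀ k + ext^ (suc m) (lift K) k              ∎)
  where
  open ≡-Reasoning
  J J′ K : Seq
  J  = frame p₁
  J′ = frame q₂
  K  = frame (p₁ ++ q₂)

LiftExtension : Path → Set
LiftExtension p = Σ Path λ q → Σ ℕ λ m → IsDyck q × frame p ≗ ext^ m (lift (frame q))

liftExtension : ∀ p → Acc (_<_ on length) p → IsDyck p → length p > 0 → LiftExtension p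
liftExtension p (acc shorter) d nonempty with factorise p d nonempty
... | p₁ , [] , refl , d₁ , _ =
  p₁ , 0 , d₁ , λ k → trans (cong (λ r → frame r k) (++-identityʳ (wrap p₁))) (frame-wrap p₁ d₁ k)
... | p₁ , p₂@(_ ∷ _) , refl , d₁ , d₂
  with liftExtension p₂ (shorter (suffix-shorter p₁ p₂)) d₂ (s≤s z≤n)
... | q₂ , m , dq₂ , eq₂ =
  p₁ ++ q₂ , suc m , DyckFrom-++ 0 0 p₁ q₂ d₁ dq₂ , frame-step p₁ p₂ q₂ m d₁ eq₂

mainTheorem5 : (p : Path) → IsDyck p → length p > 0 →
    Σ Path (λ q → Σ ℕ (λ m → IsDyck q × ((k : ℕ) → frame p k ≡ ext^ m (lift (frame q)) k)))
mainTheorem5 p = liftExtension p (wellFounded length <-wellFounded p)
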